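{- Let $P$ be a set of path axioms, $(\mathsf{Path}) \in \textit{LabSt(P)}$, $(\mathsf{Prop}) \in \textit{LabPr(P)}$, and $\mathcal{R}_{\Pi}uv := R_{\langle G_{1}\rangle}uz_{1}, \ldots, R_{\langle G_{n}\rangle}z_{n}v$. Suppose we are given a derivation that ends with an application of $(\mathsf{Prop})$ deriving $\mathcal{R}, \mathcal{R}_{\Pi}uv, R_{\langle G\rangle}uv, x: \langle F\rangle A, \Gamma$ from $\mathcal{R}, \mathcal{R}_{\Pi}uv, R_{\langle G\rangle}uv, x: \langle F\rangle A, y:A, \Gamma$, followed by an application of $(\mathsf{Path})$ deriving $\mathcal{R}, \mathcal{R}_{\Pi}uv, x: \langle F\rangle A, \Gamma$, where $\mathcal{R}_{\Pi}uv$ is active in the $(\mathsf{Path})$ inference. Then there exists a propagation rule $(\mathsf{Prop})' \in \textit{LabPr(P)}$ such that the $(\mathsf{Path})$ rule may be permuted upwards followed by an instance of $(\mathsf{Prop})'$ to derive the same end sequent: $(\mathsf{Path})$ derives $\mathcal{R}, \mathcal{R}_{\Pi}uv, x: \langle F\rangle A, y: A, \Gamma$ from $\mathcal{R}, \mathcal{R}_{\Pi}uv, R_{\langle G\rangle}uv, x: \langle F\rangle A, y:A, \Gamma$, and $(\mathsf{Prop})'$ then derives $\mathcal{R}, \mathcal{R}_{\Pi}uv, x: \langle F\rangle A, \Gamma$. ($(\mathsf{Prop})$ and $(\mathsf{Path})$ may correspond to different path axioms.)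
   Context: Tense formulae: $A ::= p \mid \overline{p} \mid A\wedge A \mid A\vee A \mid \Box A \mid \Diamond A \mid \blacksquare A \mid \Diamond^{ - }A$, with $\Diamond^{ - }$ the past diamond. $\langle F\rangle,\langle G\rangle,\langle G_i\rangle$ each denote either $\Diamond$ or $\Diamond^{ - }$; $\Diamond^{ -1}:=\Diamond^{ - }$ and $(\Diamond^{ - })^{ -1}:=\Diamond$. A path axiom has the form $\langle F_1\rangle\cdots\langle F_n\rangle A\rightarrow\langle F\rangle A$. Its inverse is $\langle F_n\rangle^{ -1}\cdots\langle F_1\rangle^{ -1}A\rightarrow\langle F\rangle^{ -1}A$, and $I(P)$ is the set of inverses of axioms in $P$. For $F=\langle F_1\rangle\cdots\langle F_n\rangle A\rightarrow\langle F\rangle A$ and $G=\langle G_1\rangle\cdots\langle G_m\rangle A\rightarrow\langle G\rangle A$ with $\langle F\rangle=\langle G_i\rangle$, the composition is $\langle G_1\rangle\cdots\langle G_{i-1}\rangle\langle F_1\rangle\cdots\langle F_n\rangle\langle G_{i+1}\rangle\cdots\langle G_m\rangle A\rightarrow\langle G\rangle A$. The completion $Q^*$ of a set $Q$ of path axioms is the least set containing $Q$, $\Diamond A\rightarrow\Diamond A$ and $\Diamond^{ - }A\rightarrow\Diamond^{ - }A$, and closed under compositions. Labeled sequents $\mathcal{R},\Gamma$ (relational atoms $Rxy$, labeled formulae $x:A$); $R_{\Diamond}xy:=Rxy$, $R_{\Diamond^{ - }}xy:=Ryx$. $\textit{LabSt(P)}$ contains, for each $\langle G_1\rangle\cdots\langle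 G_n\rangle A\rightarrow\langle G\rangle A\in P$, the rule $(\mathsf{Path})$: from $\mathcal{R},\mathcal{R}_{\Pi}uv,R_{\langle G\rangle}uv,\Gamma$ infer $\mathcal{R},\mathcal{R}_{\Pi}uv,\Gamma$ where $\mathcal{R}_{\Pi}uv= R_{\langle G_{1}\rangle}uz_{1}, \ldots, R_{\langle G_{n}\rangle}z_{n}v$. The propagation graph of $\mathcal{R},\Gamma$ has the labels as nodes and, for each $Rxy\in\mathcal{R}$, edges $(x,y,\Diamond)$ and $(y,x,\Diamond^{ - })$; a path is a sequence $n_1,\langle ?\rangle_1,n_2,\ldots,\langle ?\rangle_{k-1},n_k$ of consecutive edges (repetitions allowed), and its string is $\langle ?\rangle_1\cdots\langle ?\rangle_{k-1}$. $\textit{LabPr(P)}$ contains all rules $(\mathsf{Prop})$: from $\mathcal{R}, x: \langle F\rangle A, y:A, \Gamma$ infer $\mathcal{R}, x: \langle F\rangle A, \Gamma$, provided there is a path from $x$ to $y$ in the propagation graph of the premise whose string $\Pi$ satisfies $\Pi A \rightarrow \langle F\rangle A \in (P \cup I(P))^{*}$. -}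

module Defs where

open import Data.Nat using (ℕ)
open import Data.List using (List; []; _∷_; _++_; reverse; map)
open import Data.List.Membership.Propositional using (_∈_)
open import Data.Product using (Σ; _×_; _,_)
open import Data.Sum using (_⊎_)
open import Relation.Binary.PropositionalEquality using (_≡_)

-- Diamonds: ◇ (future diamond) and ◆ (past diamond ◇⁻)
data Dia : Set where
  ◇ ◆ : Dia

inv : Dia → Dia
inv ◇ = ◆
inv ◆ = ◇

-- Tense formulae in negation normal form
data Fml : Set where
  var  : ℕ → Fml
  nvar : ℕ → Fml
  _∧ᶠ_ : Fml → Fml → Fml
  _∨ᶠ_ : Fml → Fml → Fml
  box  : Fml → Fml
  pbox : Fml → Fml
  dia  : Dia → Fml → Fml

-- A path axiom ⟨F₁⟩⋯⟨Fₙ⟩A → ⟨F⟩A, with A schematic, is determined by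
-- the string ⟨F₁⟩⋯⟨Fₙ⟩ and the diamond ⟨F⟩.
record PathAx : Set where
  constructor _⇒_
  field
    lhs : List Dia
    rhs : Dia

AxSet : Set₁
AxSet = PathAx → Set

inverseAx : PathAx → PathAx
inverseAx (fs ⇒ f) = reverse (map inv fs) ⇒ inv f

I : AxSet → AxSet
I P a = Σ PathAx (λ b → P b × a ≡ inverseAx b)

_∪_ : AxSet → AxSet → AxSet
(P ∪ Q) a = P a ⊎ Q a

data Completion (Q : AxSet) : AxSet where
  base  : ∀ {a} → Q a → Completion Q a
  refl◇ : Completion Q ((◇ ∷ []) ⇒ ◇)
  refl◆ : Completion Q ((◆ ∷ []) ⇒ ◆)
  comp  : ∀ {fs f gs₁ gs₂ g} →
          Completion Q (fs ⇒ f) →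
          Completion Q ((gs₁ ++ f ∷ gs₂) ⇒ g) →
          Completion Q ((gs₁ ++ fs ++ gs₂) ⇒ g)

-- Labels, relational atoms Rxy (as pairs (x , y)), labelled formulae x : A
Label : Set
Label = ℕ

RelAtom : Set
RelAtom = Label × Label

LFml : Set
LFml = Label × Fml

Sequent : Set
Sequent = List RelAtom × List LFml

Rd : Dia → Label → Label → RelAtom
Rd ◇ x y = (x , y)
Rd ◆ x y = (y , x)

-- ChainAtoms u ⟨G₁⟩⋯⟨Gₙ⟩ v ℛΠ  :  ℛΠ = R_{G₁} u z₁ , R_{G₂} z₁ z₂ , … , R_{Gₙ} zₙ₋₁ v
data ChainAtoms : Label → List Dia → Label → List RelAtom → Set where
  done : ∀ {u} → ChainAtoms u [] u []
  step : ∀ {u z v g gs rs} → ChainAtoms z gs v rs →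
         ChainAtoms u (g ∷ gs) v (Rd g u z ∷ rs)

-- Edges of the propagation graph of a sequent with relational atoms ℛ:
-- each Rxy ∈ ℛ gives (x,y,◇) and (y,x,◇⁻).
data Edge (ℛ : List RelAtom) : Label → Dia → Label → Set where
  fwd : ∀ {x y} → (x , y) ∈ ℛ → Edge ℛ x ◇ y
  bwd : ∀ {x y} → (y , x) ∈ ℛ → Edge ℛ x ◆ y

data PGPath (ℛ : List RelAtom) : Label → List Dia → Label → Set where
  nil  : ∀ {x} → PGPath ℛ x [] x
  cons : ∀ {x d z ds y} → Edge ℛ x d z → PGPath ℛ z ds y → PGPath ℛ x (d ∷ ds) y

-- Instances of rules, as a relation  premise → conclusion.
-- (Path) ∈ LabSt(P)
data PathRule (P : AxSet) : Sequent → Sequent → Set where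
  path : ∀ {gs g u v ℛΠ ℛ Γ} →
         P (gs ⇒ g) → ChainAtoms u gs v ℛΠ →
         PathRule P (ℛ ++ ℛΠ ++ Rd g u v ∷ [] , Γ) (ℛ ++ ℛΠ , Γ)

data PropRule (P : AxSet) : Sequent → Sequent → Set where
  prop : ∀ {ℛ x F A y Γ Π} →
         PGPath ℛ x Π y →
         Completion (P ∪ I P) (Π ⇒ F) →
         PropRule P (ℛ , (x , dia F A) ∷ (y , A) ∷ Γ) (ℛ , (x , dia F A) ∷ Γ)

-- Every edge of the premise's propagation graph either survives the (Path)
-- step or comes from the removed atom R_⟨G⟩uv.  Such an edge is simulated in
-- the conclusion by the chain ℛΠuv (string ⟨G₁⟩⋯⟨Gₙ⟩, where ⟨G₁⟩⋯⟨Gₙ⟩ → ⟨G⟩ ∈ P)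
-- or by its reverse (string ⟨Gₙ⟩⁻¹⋯⟨G₁⟩⁻¹, where the inverse axiom is in I(P)).
-- Composing these axioms into the (P ∪ I(P))*-axiom of the original (Prop)
-- yields a path of the smaller graph whose string still derives ⟨F⟩, i.e. a
-- valid (Prop)' instance.
module Submission where

open import Defs
open import Data.List using (List; []; _∷_; _++_; reverse; map)
open import Data.List.Membership.Propositional using (_∈_)
open import Data.List.Membership.Propositional.Properties using (∈-++⁺ˡ; ∈-++⁺ʳ; ∈-++⁻)
open import Data.List.Properties using (++-assoc; unfold-reverse)
open import Data.List.Relation.Binary.Subset.Propositional using (_⊆_)
open import Data.List.Relation.Unary.Any using (here)
open import Data.Product using (Σ-syntax; _×_; _,_)
open import Data.Sum using (_⊎_; inj₁; inj₂; [_,_]′)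
open import Relation.Binary.PropositionalEquality using (_≡_; refl; sym; subst)

Edge-mono : ∀ {ℛ ℛ′ x d y} → ℛ ⊆ ℛ′ → Edge ℛ x d y → Edge ℛ′ x d y
Edge-mono ℛ⊆ℛ′ (fwd r) = fwd (ℛ⊆ℛ′ r)
Edge-mono ℛ⊆ℛ′ (bwd r) = bwd (ℛ⊆ℛ′ r)

PGPath-mono : ∀ {ℛ ℛ′ x ds y} → ℛ ⊆ ℛ′ → PGPath ℛ x ds y → PGPath ℛ′ x ds y
PGPath-mono ℛ⊆ℛ′ nil        = nil
PGPath-mono ℛ⊆ℛ′ (cons e p) = cons (Edge-mono ℛ⊆ℛ′ e) (PGPath-mono ℛ⊆ℛ′ p)

_++ᵖ_ : ∀ {ℛ x ds y es z} → PGPath ℛ x ds y → PGPath ℛ y es z → PGPath ℛ x (ds ++ es) z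
nil      ++ᵖ q = q
cons e p ++ᵖ q = cons e (p ++ᵖ q)

Edge-reverse : ∀ {ℛ x d y} → Edge ℛ x d y → Edge ℛ y (inv d) x
Edge-reverse (fwd r) = bwd r
Edge-reverse (bwd r) = fwd r

PGPath-reverse : ∀ {ℛ x ds y} → PGPath ℛ x ds y → PGPath ℛ y (reverse (map inv ds)) x
PGPath-reverse nil = nil
PGPath-reverse {ℛ} {x} (cons {d = d} {ds = ds} e p) =
  subst (λ es → PGPath ℛ _ es x) (sym (unfold-reverse (inv d) (map inv ds)))
        (PGPath-reverse p ++ᵖ cons (Edge-reverse e) nil)

ChainAtoms⇒PGPath : ∀ {u gs v ℛΠ} → ChainAtoms u gs v ℛΠ → PGPath ℛΠ u gs v
ChainAtoms⇒PGPath done = nil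
ChainAtoms⇒PGPath (step {g = ◇} c) = cons (fwd (here refl)) (PGPath-mono (∈-++⁺ʳ _) (ChainAtoms⇒PGPath c))
ChainAtoms⇒PGPath (step {g = ◆} c) = cons (bwd (here refl)) (PGPath-mono (∈-++⁺ʳ _) (ChainAtoms⇒PGPath c))

Edge-++⁻ : ∀ ℛ {ℛ′ x d y} → Edge (ℛ ++ ℛ′) x d y → Edge ℛ x d y ⊎ Edge ℛ′ x d y
Edge-++⁻ ℛ (fwd r) = [ (λ r → inj₁ (fwd r)) , (λ r → inj₂ (fwd r)) ]′ (∈-++⁻ ℛ r)
Edge-++⁻ ℛ (bwd r) = [ (λ r → inj₁ (bwd r)) , (λ r → inj₂ (bwd r)) ]′ (∈-++⁻ ℛ r)

Edge-Rd : ∀ {g u v x d y} → Edge (Rd g u v ∷ []) x d y →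
          (d , x , y) ≡ (g , u , v) ⊎ (d , x , y) ≡ (inv g , v , u)
Edge-Rd {◇} (fwd (here refl)) = inj₁ refl
Edge-Rd {◆} (fwd (here refl)) = inj₂ refl
Edge-Rd {◇} (bwd (here refl)) = inj₂ refl
Edge-Rd {◆} (bwd (here refl)) = inj₁ refl

Completion-refl : ∀ {Q} d → Completion Q ((d ∷ []) ⇒ d)
Completion-refl ◇ = refl◇
Completion-refl ◆ = refl◆

Completion-resp : ∀ {Q ds es f} → ds ≡ es → Completion Q (ds ⇒ f) → Completion Q (es ⇒ f)
Completion-resp refl c = c

Simulates : AxSet → List RelAtom → List RelAtom → Set
Simulates Q ℛ ℛ′ = ∀ {x d y} → Edge ℛ′ x d y →
                   Σ[ cs ∈ List Dia ] PGPath ℛ x cs y × Completion Q (cs ⇒ d)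

simulates-⊆ : ∀ {Q ℛ ℛ′} → ℛ′ ⊆ ℛ → Simulates Q ℛ ℛ′
simulates-⊆ ℛ′⊆ℛ {d = d} e = d ∷ [] , cons (Edge-mono ℛ′⊆ℛ e) nil , Completion-refl d

simulates-++ : ∀ {Q ℛ} ℛ₁ {ℛ₂} → Simulates Q ℛ ℛ₁ → Simulates Q ℛ ℛ₂ → Simulates Q ℛ (ℛ₁ ++ ℛ₂)
simulates-++ ℛ₁ sim₁ sim₂ e = [ sim₁ , sim₂ ]′ (Edge-++⁻ ℛ₁ e)

simulates-axiom : ∀ {P ℛ gs g u v} → P (gs ⇒ g) → PGPath ℛ u gs v →
                  Simulates (P ∪ I P) ℛ (Rd g u v ∷ [])
simulates-axiom {gs = gs} {g} ax p e with Edge-Rd e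
... | inj₁ refl = gs , p , base (inj₁ ax)
... | inj₂ refl = reverse (map inv gs) , PGPath-reverse p , base (inj₂ (gs ⇒ g , ax , refl))

-- The prefix pre is the part of the string already rewritten.
simulate-PGPath : ∀ {Q ℛ ℛ′ x Π y F} → Simulates Q ℛ ℛ′ → (pre : List Dia) →
                  PGPath ℛ′ x Π y → Completion Q ((pre ++ Π) ⇒ F) →
                  Σ[ Π′ ∈ List Dia ] PGPath ℛ x Π′ y × Completion Q ((pre ++ Π′) ⇒ F)
simulate-PGPath sim pre nil c = [] , nil , c
simulate-PGPath sim pre (cons {ds = ds} e p) c with sim e
... | cs , q , cs⇒d with simulate-PGPath sim (pre ++ cs) p
                           (Completion-resp (sym (++-assoc pre cs ds)) (comp {gs₁ = pre} cs⇒d c))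
...   | Π′ , p′ , c′ = cs ++ Π′ , q ++ᵖ p′ , Completion-resp (++-assoc pre cs Π′) c′

lemma5p8 : (P : AxSet) (ℛ ℛΠ : List RelAtom) (gs : List Dia) (g F : Dia)
    (u v x y : Label) (A : Fml) (Γ : List LFml) →
    P (gs ⇒ g) → ChainAtoms u gs v ℛΠ →
    PropRule P (ℛ ++ ℛΠ ++ Rd g u v ∷ [] , (x , dia F A) ∷ (y , A) ∷ Γ)
    (ℛ ++ ℛΠ ++ Rd g u v ∷ [] , (x , dia F A) ∷ Γ) →
    PathRule P (ℛ ++ ℛΠ ++ Rd g u v ∷ [] , (x , dia F A) ∷ Γ)
    (ℛ ++ ℛΠ , (x , dia F A) ∷ Γ) →
    PathRule P (ℛ ++ ℛΠ ++ Rd g u v ∷ [] , (x , dia F A) ∷ (y , A) ∷ Γ)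
    (ℛ ++ ℛΠ , (x , dia F A) ∷ (y , A) ∷ Γ)
    × PropRule P (ℛ ++ ℛΠ , (x , dia F A) ∷ (y , A) ∷ Γ)
    (ℛ ++ ℛΠ , (x , dia F A) ∷ Γ)
lemma5p8 P ℛ ℛΠ gs g F u v x y A Γ ax chain (prop p c) _ =
  let Π′ , p′ , c′ = simulate-PGPath sim [] p c in path ax chain , prop p′ c′
  where
  chainPath : PGPath (ℛ ++ ℛΠ) u gs v
  chainPath = PGPath-mono (∈-++⁺ʳ ℛ) (ChainAtoms⇒PGPath chain)

  sim : Simulates (P ∪ I P) (ℛ ++ ℛΠ) (ℛ ++ ℛΠ ++ Rd g u v ∷ [])
  sim = simulates-++ ℛ (simulates-⊆ ∈-++⁺ˡ)
          (simulates-++ ℛΠ (simulates-⊆ (∈-++⁺ʳ ℛ)) (simulates-axiom ax chainPath))
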